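{- For all positive integers $n,s$, $$\sum_{k=0}^{n-1}\frac{1}{(2k+1)^s}=\sum_{k=1}^n(-1)^{k-1}\binom{n}{k}\,{}_{s+1}F_s\left(\tfrac12,\ldots,\tfrac12,1-k;\tfrac32,\ldots,\tfrac32;1\right),$$ where $\tfrac12$ and $\tfrac32$ each appear $s$ times.
   Context: ${}_{s+1}F_s(a_1,\ldots,a_{s+1};b_1,\ldots,b_s;x)=\sum_{i\ge0}\frac{(a_1)_i\cdots(a_{s+1})_i}{(b_1)_i\cdots(b_s)_i}\frac{x^i}{i!}$, with $(a)_0=1$, $(a)_i=a(a+1)\cdots(a+i-1)$; with an upper parameter $1-k$ ($k$ a positive integer) the series terminates. -}

module Defs where

open import Data.Nat using (ℕ; zero; suc)
open import Data.Nat.Combinatorics using (_C_)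
open import Data.Integer using (+_)
open import Data.Rational using (ℚ; 0ℚ; 1ℚ; _+_; _*_; _-_; -_; _/_; 1/_; _≟_)
import Data.Rational as ℚ
open import Data.List using (List; []; _∷_; replicate; foldr; map)
open import Relation.Nullary using (yes; no)
open import Relation.Nullary.Negation using (contradiction)

ℕ→ℚ : ℕ → ℚ
ℕ→ℚ n = + n / 1

-- total division on ℚ (q ÷ 0 := 0); only ever applied to nonzero divisors below
infixl 7 _÷ᵗ_
_÷ᵗ_ : ℚ → ℚ → ℚ
p ÷ᵗ q with q ≟ 0ℚ
... | yes _ = 0ℚ
... | no q≢0 = p * (1/_ q {{ℚ.≢-nonZero q≢0}})

poch : ℚ → ℕ → ℚ
poch a zero = 1ℚ
poch a (suc i) = poch a i * (a + ℕ→ℚ i)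

prodℚ : List ℚ → ℚ
prodℚ = foldr _*_ 1ℚ

_^ℚ_ : ℚ → ℕ → ℚ
x ^ℚ zero = 1ℚ
x ^ℚ suc n = (x ^ℚ n) * x

fact : ℕ → ℚ
fact zero = 1ℚ
fact (suc n) = fact n * ℕ→ℚ (suc n)

Σ< : ℕ → (ℕ → ℚ) → ℚ
Σ< zero f = 0ℚ
Σ< (suc n) f = Σ< n f + f n

hgTerm : List ℚ → List ℚ → ℚ → ℕ → ℚ
hgTerm as bs x i =
  (prodℚ (map (λ a → poch a i) as) * (x ^ℚ i))
    ÷ᵗ (prodℚ (map (λ b → poch b i) bs) * fact i)

hgPartial : List ℚ → List ℚ → ℚ → ℕ → ℚ
hgPartial as bs x N = Σ< N (hgTerm as bs x)

-- The terminating series {}_{s+1}F_s(a_1..a_s, 1-k; b_1..b_s; x) for a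
-- positive integer k: (1-k)_i = 0 for all i ≥ k, so the full series equals
-- the finite sum over i = 0 .. k-1 (we sum to i = k inclusive, the extra
-- term being zero).
hypergeomTerm : (k : ℕ) → List ℚ → List ℚ → ℚ → ℚ
hypergeomTerm k as bs x = hgPartial (as Data.List.++ (1ℚ - ℕ→ℚ k ∷ [])) bs x (suc k)

half threeHalves : ℚ
half = + 1 / 2
threeHalves = + 3 / 2

sign : ℕ → ℚ
sign zero = 1ℚ
sign (suc n) = - sign n

lhs : ℕ → ℕ → ℚ
lhs n s = Σ< n (λ k → 1ℚ ÷ᵗ (ℕ→ℚ (2 Data.Nat.* k Data.Nat.+ 1) ^ℚ s))

rhs : ℕ → ℕ → ℚ
rhs n s = Σ< n (λ j → sign j * ℕ→ℚ (n C suc j)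
            * hypergeomTerm (suc j) (replicate s half) (replicate s threeHalves) 1ℚ)

-- Put a i = (2i+1)^(-s) and let T be the alternating binomial transform,
-- (T a) j = Σ_{i ≤ j} (-1)^i C(j,i) a i.  Since (1/2)_i / (3/2)_i = 1/(2i+1) and
-- (1-k)_i / i! = (-1)^i C(k-1,i), the k-th hypergeometric value is (T a) (k-1).
-- The remaining identity Σ_{k<n} a k = Σ_{j<n} (-1)^j C(n,j+1) (T a) j holds for
-- every sequence a: by Pascal's rule T a (j+1) = T a j - T (a ∘ suc) j, which
-- makes T an involution, and Pascal's rule once more reduces the sum over C(n+1,j+1)
-- to T (T a) n = a n plus the same sum for n.
module Submission where

open import Defs
open import Data.Nat using (ℕ; zero; suc; _≤_)
import Data.Nat as ℕ
open import Data.Nat.Combinatorics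
  using (_C_; nCk+nC[k+1]≡[n+1]C[k+1]; k>n⇒nCk≡0; nC1≡n)
open import Data.Nat.Coprimality as Coprime using (1-coprimeTo)
import Data.Nat.Properties as ℕ
import Data.Integer as ℤ
import Data.Integer.Properties as ℤ
open import Data.Rational
  using (ℚ; mkℚ; _/_; 0ℚ; 1ℚ; _+_; _*_; _-_; -_; 1/_; _≟_; Positive; NonNegative; ≢-nonZero)
open import Data.Rational.Properties
  using ( +-*-commutativeRing; normalize-coprime; /-cong; normalize-pos; normalize-nonNeg
        ; pos*pos⇒pos; pos+nonNeg⇒pos; positive⁻¹; <⇒≢; +-identityʳ; +-assoc; +-comm; *-identityˡ
        ; *-identityʳ; *-zeroˡ; *-assoc; *-comm; *-distribˡ-+; *-distribʳ-+
        ; *-inverseˡ; *-inverseʳ)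
open import Data.List using (List; []; _∷_; replicate; map; _++_)
open import Data.List.Properties using (map-++)
open import Data.Empty using (⊥-elim)
open import Relation.Nullary using (yes; no)
open import Relation.Nullary.Decidable using (dec⇒maybe)
open import Relation.Binary.PropositionalEquality
  using (_≡_; _≢_; refl; sym; trans; cong; cong₂; subst; ≢-sym; module ≡-Reasoning)
open import Tactic.RingSolver using (solve-∀)
open import Tactic.RingSolver.Core.AlmostCommutativeRing
  using (AlmostCommutativeRing; fromCommutativeRing)

open ≡-Reasoning

ℚ-ring : AlmostCommutativeRing _ _
ℚ-ring = fromCommutativeRing +-*-commutativeRing (λ x → dec⇒maybe (0ℚ ≟ x))

ℕ→ℚ-mkℚ : ∀ n → ℕ→ℚ n ≡ mkℚ (ℤ.+ n) 0 (Coprime.sym (1-coprimeTo n))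
ℕ→ℚ-mkℚ n = normalize-coprime (Coprime.sym (1-coprimeTo n))

ℕ→ℚ-+ : ∀ m n → ℕ→ℚ (m ℕ.+ n) ≡ ℕ→ℚ m + ℕ→ℚ n
ℕ→ℚ-+ m n = sym (begin
  ℕ→ℚ m + ℕ→ℚ n                             ≡⟨ cong₂ _+_ (ℕ→ℚ-mkℚ m) (ℕ→ℚ-mkℚ n) ⟩
  (ℤ.+ m ℤ.* ℤ.+ 1 ℤ.+ ℤ.+ n ℤ.* ℤ.+ 1) / 1 ≡⟨ /-cong numerators refl ⟩
  ℕ→ℚ (m ℕ.+ n)                             ∎)
  where
  numerators : ℤ.+ m ℤ.* ℤ.+ 1 ℤ.+ ℤ.+ n ℤ.* ℤ.+ 1 ≡ ℤ.+ (m ℕ.+ n)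
  numerators = cong₂ ℤ._+_ (ℤ.*-identityʳ (ℤ.+ m)) (ℤ.*-identityʳ (ℤ.+ n))

ℕ→ℚ-suc : ∀ n → ℕ→ℚ (suc n) ≡ 1ℚ + ℕ→ℚ n
ℕ→ℚ-suc = ℕ→ℚ-+ 1

ℕ→ℚ-odd : ∀ i → ℕ→ℚ (2 ℕ.* i ℕ.+ 1) ≡ ℕ→ℚ i + ℕ→ℚ i + 1ℚ
ℕ→ℚ-odd i = begin
  ℕ→ℚ (2 ℕ.* i ℕ.+ 1)        ≡⟨ ℕ→ℚ-+ (2 ℕ.* i) 1 ⟩
  ℕ→ℚ (i ℕ.+ (i ℕ.+ 0)) + 1ℚ ≡⟨ cong (λ m → ℕ→ℚ (i ℕ.+ m) + 1ℚ) (ℕ.+-identityʳ i) ⟩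
  ℕ→ℚ (i ℕ.+ i) + 1ℚ         ≡⟨ cong (_+ 1ℚ) (ℕ→ℚ-+ i i) ⟩
  ℕ→ℚ i + ℕ→ℚ i + 1ℚ         ∎

ℕ→ℚ-nonNeg : ∀ n → NonNegative (ℕ→ℚ n)
ℕ→ℚ-nonNeg n = normalize-nonNeg n 1

ℕ→ℚ-suc-pos : ∀ n → Positive (ℕ→ℚ (suc n))
ℕ→ℚ-suc-pos n = normalize-pos (suc n) 1

ℕ→ℚ-odd-pos : ∀ i → Positive (ℕ→ℚ (2 ℕ.* i ℕ.+ 1))
ℕ→ℚ-odd-pos i = subst (λ m → Positive (ℕ→ℚ m)) (ℕ.+-comm 1 (2 ℕ.* i)) (ℕ→ℚ-suc-pos (2 ℕ.* i))

pos⇒≢0 : ∀ {p} → Positive p → p ≢ 0ℚ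
pos⇒≢0 {p} p>0 = ≢-sym (<⇒≢ (positive⁻¹ p {{p>0}}))

^ℚ-pos : ∀ a .{{_ : Positive a}} n → Positive (a ^ℚ n)
^ℚ-pos a zero    = _
^ℚ-pos a (suc n) = pos*pos⇒pos (a ^ℚ n) {{^ℚ-pos a n}} a

poch-pos : ∀ a .{{_ : Positive a}} i → Positive (poch a i)
poch-pos a zero    = _
poch-pos a (suc i) =
  pos*pos⇒pos (poch a i) {{poch-pos a i}} (a + ℕ→ℚ i) {{pos+nonNeg⇒pos a (ℕ→ℚ i) {{ℕ→ℚ-nonNeg i}}}}

fact-pos : ∀ n → Positive (fact n)
fact-pos zero    = _
fact-pos (suc n) = pos*pos⇒pos (fact n) {{fact-pos n}} (ℕ→ℚ (suc n)) {{ℕ→ℚ-suc-pos n}}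

÷ᵗ-unique : ∀ {p q r} → q ≢ 0ℚ → r * q ≡ p → p ÷ᵗ q ≡ r
÷ᵗ-unique {p} {q} {r} q≢0 r*q≡p with q ≟ 0ℚ
... | yes q≡0 = ⊥-elim (q≢0 q≡0)
... | no q≢0′ = begin
  p * 1/ q         ≡⟨ cong (_* 1/ q) (sym r*q≡p) ⟩
  r * q * 1/ q     ≡⟨ *-assoc r q (1/ q) ⟩
  r * (q * 1/ q)   ≡⟨ cong (r *_) (*-inverseʳ q) ⟩
  r * 1ℚ           ≡⟨ *-identityʳ r ⟩
  r                ∎
  where instance _ = ≢-nonZero q≢0′

÷ᵗ-*-cancel : ∀ p q → q ≢ 0ℚ → (p ÷ᵗ q) * q ≡ p
÷ᵗ-*-cancel p q q≢0 with q ≟ 0ℚ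
... | yes q≡0 = ⊥-elim (q≢0 q≡0)
... | no q≢0′ = begin
  p * 1/ q * q     ≡⟨ *-assoc p (1/ q) q ⟩
  p * (1/ q * q)   ≡⟨ cong (p *_) (*-inverseˡ q) ⟩
  p * 1ℚ           ≡⟨ *-identityʳ p ⟩
  p                ∎
  where instance _ = ≢-nonZero q≢0′

1^ℚ : ∀ n → 1ℚ ^ℚ n ≡ 1ℚ
1^ℚ zero    = refl
1^ℚ (suc n) = trans (*-identityʳ _) (1^ℚ n)

^ℚ-*-distrib : ∀ a b n → (a * b) ^ℚ n ≡ a ^ℚ n * b ^ℚ n
^ℚ-*-distrib a b zero    = refl
^ℚ-*-distrib a b (suc n) = begin
  (a * b) ^ℚ n * (a * b)        ≡⟨ cong (_* (a * b)) (^ℚ-*-distrib a b n) ⟩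
  a ^ℚ n * b ^ℚ n * (a * b)     ≡⟨ interchange (a ^ℚ n) (b ^ℚ n) a b ⟩
  a ^ℚ n * a * (b ^ℚ n * b)     ∎
  where
  interchange : ∀ x y u v → x * y * (u * v) ≡ x * u * (y * v)
  interchange = solve-∀ ℚ-ring

prodℚ-++ : ∀ xs ys → prodℚ (xs ++ ys) ≡ prodℚ xs * prodℚ ys
prodℚ-++ []       ys = sym (*-identityˡ (prodℚ ys))
prodℚ-++ (x ∷ xs) ys =
  trans (cong (x *_) (prodℚ-++ xs ys)) (sym (*-assoc x (prodℚ xs) (prodℚ ys)))

prodℚ-map-replicate : ∀ (f : ℚ → ℚ) x s → prodℚ (map f (replicate s x)) ≡ f x ^ℚ s
prodℚ-map-replicate f x zero    = refl
prodℚ-map-replicate f x (suc s) =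
  trans (cong (f x *_) (prodℚ-map-replicate f x s)) (*-comm (f x) (f x ^ℚ s))

Σ<-cong : ∀ n {f g : ℕ → ℚ} → (∀ i → f i ≡ g i) → Σ< n f ≡ Σ< n g
Σ<-cong zero    f≗g = refl
Σ<-cong (suc n) f≗g = cong₂ _+_ (Σ<-cong n f≗g) (f≗g n)

Σ<-front : ∀ n (f : ℕ → ℚ) → Σ< (suc n) f ≡ f 0 + Σ< n (λ i → f (suc i))
Σ<-front zero    f = +-comm 0ℚ (f 0)
Σ<-front (suc n) f = begin
  Σ< (suc n) f + f (suc n)                     ≡⟨ cong (_+ f (suc n)) (Σ<-front n f) ⟩
  f 0 + Σ< n (λ i → f (suc i)) + f (suc n)     ≡⟨ +-assoc (f 0) _ _ ⟩
  f 0 + (Σ< n (λ i → f (suc i)) + f (suc n))   ∎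

Σ<-extend : ∀ n {f : ℕ → ℚ} → f n ≡ 0ℚ → Σ< (suc n) f ≡ Σ< n f
Σ<-extend n {f} fn≡0 = trans (cong (Σ< n f +_) fn≡0) (+-identityʳ (Σ< n f))

Σ<-+ : ∀ n (f g : ℕ → ℚ) → Σ< n (λ i → f i + g i) ≡ Σ< n f + Σ< n g
Σ<-+ zero    f g = refl
Σ<-+ (suc n) f g = begin
  Σ< n (λ i → f i + g i) + (f n + g n)  ≡⟨ cong (_+ (f n + g n)) (Σ<-+ n f g) ⟩
  Σ< n f + Σ< n g + (f n + g n)         ≡⟨ interchange (Σ< n f) (Σ< n g) (f n) (g n) ⟩
  Σ< n f + f n + (Σ< n g + g n)         ∎
  where
  interchange : ∀ a b c d → a + b + (c + d) ≡ a + c + (b + d)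
  interchange = solve-∀ ℚ-ring

Σ<-- : ∀ n (f g : ℕ → ℚ) → Σ< n (λ i → f i - g i) ≡ Σ< n f - Σ< n g
Σ<-- zero    f g = refl
Σ<-- (suc n) f g = begin
  Σ< n (λ i → f i - g i) + (f n - g n)  ≡⟨ cong (_+ (f n - g n)) (Σ<-- n f g) ⟩
  Σ< n f - Σ< n g + (f n - g n)         ≡⟨ interchange (Σ< n f) (Σ< n g) (f n) (g n) ⟩
  Σ< n f + f n - (Σ< n g + g n)         ∎
  where
  interchange : ∀ a b c d → a - b + (c - d) ≡ a + c - (b + d)
  interchange = solve-∀ ℚ-ring

binom : ℕ → ℕ → ℚ
binom n k = ℕ→ℚ (n C k)

binom-pascal : ∀ n k → binom (suc n) (suc k) ≡ binom n k + binom n (suc k)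
binom-pascal n k = trans (cong ℕ→ℚ (sym (nCk+nC[k+1]≡[n+1]C[k+1] n k))) (ℕ→ℚ-+ (n C k) (n C suc k))

binom-pascal-* : ∀ n k x → binom (suc n) (suc k) * x ≡ binom n k * x + binom n (suc k) * x
binom-pascal-* n k x = trans (cong (_* x) (binom-pascal n k)) (*-distribʳ-+ x (binom n k) (binom n (suc k)))

binom[n,1+n]*x≡0 : ∀ n x → binom n (suc n) * x ≡ 0ℚ
binom[n,1+n]*x≡0 n x = trans (cong (λ m → ℕ→ℚ m * x) (k>n⇒nCk≡0 (ℕ.n<1+n n))) (*-zeroˡ x)

binom-absorb : ∀ j i → binom j i * (ℕ→ℚ j - ℕ→ℚ i) ≡ binom j (suc i) * ℕ→ℚ (suc i)
binom-absorb zero    zero    = refl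
binom-absorb zero    (suc i) = trans (*-zeroˡ (0ℚ - ℕ→ℚ (suc i))) (sym (*-zeroˡ (ℕ→ℚ (suc (suc i)))))
binom-absorb (suc j) zero    = begin
  1ℚ * (ℕ→ℚ (suc j) - 0ℚ)   ≡⟨ simplify (ℕ→ℚ (suc j)) ⟩
  ℕ→ℚ (suc j) * 1ℚ          ≡⟨ cong (λ m → ℕ→ℚ m * 1ℚ) (sym (nC1≡n (suc j))) ⟩
  binom (suc j) 1 * 1ℚ      ∎
  where
  simplify : ∀ x → 1ℚ * (x - 0ℚ) ≡ x * 1ℚ
  simplify = solve-∀ ℚ-ring
binom-absorb (suc j) (suc i) = begin
  binom (suc j) (suc i) * (ℕ→ℚ (suc j) - ℕ→ℚ (suc i))
    ≡⟨ cong₂ (λ b d → b * d) (binom-pascal j i) (shift j i) ⟩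
  (binom j i + B₁) * (J - I)
    ≡⟨ *-distribʳ-+ (J - I) (binom j i) B₁ ⟩
  binom j i * (J - I) + B₁ * (J - I)
    ≡⟨ cong (_+ B₁ * (J - I)) (binom-absorb j i) ⟩
  B₁ * ℕ→ℚ (suc i) + B₁ * (J - I)
    ≡⟨ cong (λ x → B₁ * x + B₁ * (J - I)) (ℕ→ℚ-suc i) ⟩
  B₁ * (1ℚ + I) + B₁ * (J - I)
    ≡⟨ regroup B₁ J I ⟩
  B₁ * (1ℚ + (1ℚ + I)) + B₁ * (J - (1ℚ + I))
    ≡⟨ cong (λ x → B₁ * (1ℚ + x) + B₁ * (J - x)) (sym (ℕ→ℚ-suc i)) ⟩
  B₁ * (1ℚ + ℕ→ℚ (suc i)) + B₁ * (J - ℕ→ℚ (suc i))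
    ≡⟨ cong₂ (λ x y → B₁ * x + y) (sym (ℕ→ℚ-suc (suc i))) (binom-absorb j (suc i)) ⟩
  B₁ * ℕ→ℚ (suc (suc i)) + B₂ * ℕ→ℚ (suc (suc i))
    ≡⟨ sym (*-distribʳ-+ (ℕ→ℚ (suc (suc i))) B₁ B₂) ⟩
  (B₁ + B₂) * ℕ→ℚ (suc (suc i))
    ≡⟨ cong (_* ℕ→ℚ (suc (suc i))) (sym (binom-pascal j (suc i))) ⟩
  binom (suc j) (suc (suc i)) * ℕ→ℚ (suc (suc i))
    ∎
  where
  J = ℕ→ℚ j
  I = ℕ→ℚ i
  B₁ = binom j (suc i)
  B₂ = binom j (suc (suc i))
  shift : ∀ j i → ℕ→ℚ (suc j) - ℕ→ℚ (suc i) ≡ ℕ→ℚ j - ℕ→ℚ i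
  shift j i = trans (cong₂ _-_ (ℕ→ℚ-suc j) (ℕ→ℚ-suc i)) (cancel (ℕ→ℚ j) (ℕ→ℚ i))
    where
    cancel : ∀ x y → 1ℚ + x - (1ℚ + y) ≡ x - y
    cancel = solve-∀ ℚ-ring
  regroup : ∀ b x y → b * (1ℚ + y) + b * (x - y) ≡ b * (1ℚ + (1ℚ + y)) + b * (x - (1ℚ + y))
  regroup = solve-∀ ℚ-ring

Σ-binom-front : ∀ n (f : ℕ → ℚ) →
  Σ< (suc n) (λ j → binom n j * f j) ≡ f 0 + Σ< (suc n) (λ j → binom n (suc j) * f (suc j))
Σ-binom-front n f = begin
  Σ< (suc n) (λ j → binom n j * f j)
    ≡⟨ Σ<-front n _ ⟩
  1ℚ * f 0 + Σ< n (λ j → binom n (suc j) * f (suc j))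
    ≡⟨ cong₂ _+_ (*-identityˡ (f 0)) (sym (Σ<-extend n (binom[n,1+n]*x≡0 n (f (suc n))))) ⟩
  f 0 + Σ< (suc n) (λ j → binom n (suc j) * f (suc j))
    ∎

Σ-binom-pascal : ∀ n (f : ℕ → ℚ) →
  Σ< (suc (suc n)) (λ j → binom (suc n) j * f j) ≡ Σ< (suc n) (λ j → binom n j * (f j + f (suc j)))
Σ-binom-pascal n f = begin
  Σ< (suc (suc n)) (λ j → binom (suc n) j * f j)
    ≡⟨ Σ<-front (suc n) _ ⟩
  1ℚ * f 0 + Σ< (suc n) (λ j → binom (suc n) (suc j) * f (suc j))
    ≡⟨ cong (_+ Σ< (suc n) (λ j → binom (suc n) (suc j) * f (suc j))) (*-identityˡ (f 0)) ⟩
  f 0 + Σ< (suc n) (λ j → binom (suc n) (suc j) * f (suc j))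
    ≡⟨ cong (f 0 +_) (Σ<-cong (suc n) (λ j → binom-pascal-* n j (f (suc j)))) ⟩
  f 0 + Σ< (suc n) (λ j → binom n j * f (suc j) + binom n (suc j) * f (suc j))
    ≡⟨ cong (f 0 +_) (Σ<-+ (suc n) _ _) ⟩
  f 0 + (Σ< (suc n) (λ j → binom n j * f (suc j)) + Σ< (suc n) (λ j → binom n (suc j) * f (suc j)))
    ≡⟨ rotate (f 0) _ _ ⟩
  (f 0 + Σ< (suc n) (λ j → binom n (suc j) * f (suc j))) + Σ< (suc n) (λ j → binom n j * f (suc j))
    ≡⟨ cong (_+ Σ< (suc n) (λ j → binom n j * f (suc j))) (sym (Σ-binom-front n f)) ⟩
  Σ< (suc n) (λ j → binom n j * f j) + Σ< (suc n) (λ j → binom n j * f (suc j))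
    ≡⟨ sym (Σ<-+ (suc n) _ _) ⟩
  Σ< (suc n) (λ j → binom n j * f j + binom n j * f (suc j))
    ≡⟨ Σ<-cong (suc n) (λ j → sym (*-distribˡ-+ (binom n j) (f j) (f (suc j)))) ⟩
  Σ< (suc n) (λ j → binom n j * (f j + f (suc j)))
    ∎
  where
  rotate : ∀ a b c → a + (b + c) ≡ (a + c) + b
  rotate = solve-∀ ℚ-ring

-- The alternating binomial transform

binomialTransform : (ℕ → ℚ) → ℕ → ℚ
binomialTransform a n = Σ< (suc n) (λ i → binom n i * (sign i * a i))

binomialTransform-suc : ∀ (a : ℕ → ℚ) n →
  binomialTransform a (suc n) ≡ binomialTransform a n - binomialTransform (λ i → a (suc i)) n
binomialTransform-suc a n = begin
  binomialTransform a (suc n)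
    ≡⟨ Σ-binom-pascal n (λ i → sign i * a i) ⟩
  Σ< (suc n) (λ i → binom n i * (sign i * a i + - sign i * a (suc i)))
    ≡⟨ Σ<-cong (suc n) (λ i → distribute (binom n i) (sign i) (a i) (a (suc i))) ⟩
  Σ< (suc n) (λ i → binom n i * (sign i * a i) - binom n i * (sign i * a (suc i)))
    ≡⟨ Σ<-- (suc n) _ _ ⟩
  binomialTransform a n - binomialTransform (λ i → a (suc i)) n
    ∎
  where
  distribute : ∀ b s x y → b * (s * x + - s * y) ≡ b * (s * x) - b * (s * y)
  distribute = solve-∀ ℚ-ring

binomialTransform-involutive : ∀ n (a : ℕ → ℚ) → binomialTransform (binomialTransform a) n ≡ a n
binomialTransform-involutive zero    a = unfold (a 0)
  where
  unfold : ∀ x → 0ℚ + 1ℚ * (1ℚ * (0ℚ + 1ℚ * (1ℚ * x))) ≡ x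
  unfold = solve-∀ ℚ-ring
binomialTransform-involutive (suc n) a = begin
  binomialTransform (binomialTransform a) (suc n)
    ≡⟨ Σ-binom-pascal n (λ j → sign j * binomialTransform a j) ⟩
  Σ< (suc n) (λ j → binom n j * (sign j * binomialTransform a j + - sign j * binomialTransform a (suc j)))
    ≡⟨ Σ<-cong (suc n) (λ j → cong (binom n j *_) (alternate j)) ⟩
  binomialTransform (binomialTransform (λ i → a (suc i))) n
    ≡⟨ binomialTransform-involutive n (λ i → a (suc i)) ⟩
  a (suc n)
    ∎
  where
  cancel : ∀ s x y → s * x + - s * (x - y) ≡ s * y
  cancel = solve-∀ ℚ-ring
  alternate : ∀ j → sign j * binomialTransform a j + - sign j * binomialTransform a (suc j)
                  ≡ sign j * binomialTransform (λ i → a (suc i)) j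
  alternate j = trans (cong (λ t → sign j * binomialTransform a j + - sign j * t) (binomialTransform-suc a j))
                      (cancel (sign j) _ _)

Σ<-binomialTransform : ∀ n (a : ℕ → ℚ) →
  Σ< n (λ j → binom n (suc j) * (sign j * binomialTransform a j)) ≡ Σ< n a
Σ<-binomialTransform zero    a = refl
Σ<-binomialTransform (suc n) a = begin
  Σ< (suc n) (λ j → binom (suc n) (suc j) * h j)
    ≡⟨ Σ<-cong (suc n) (λ j → binom-pascal-* n j (h j)) ⟩
  Σ< (suc n) (λ j → binom n j * h j + binom n (suc j) * h j)
    ≡⟨ Σ<-+ (suc n) _ _ ⟩
  binomialTransform (binomialTransform a) n + Σ< (suc n) (λ j → binom n (suc j) * h j)
    ≡⟨ cong₂ _+_ (binomialTransform-involutive n a) (Σ<-extend n (binom[n,1+n]*x≡0 n (h n))) ⟩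
  a n + Σ< n (λ j → binom n (suc j) * h j)
    ≡⟨ cong (a n +_) (Σ<-binomialTransform n a) ⟩
  a n + Σ< n a
    ≡⟨ +-comm (a n) (Σ< n a) ⟩
  Σ< n a + a n
    ∎
  where
  h : ℕ → ℚ
  h j = sign j * binomialTransform a j

poch-neg : ∀ j i → poch (- ℕ→ℚ j) i ≡ sign i * binom j i * fact i
poch-neg j zero    = refl
poch-neg j (suc i) = begin
  poch (- J) i * (- J + I)                 ≡⟨ cong (_* (- J + I)) (poch-neg j i) ⟩
  sign i * binom j i * fact i * (- J + I)  ≡⟨ pull (sign i) (binom j i) (fact i) J I ⟩
  - sign i * fact i * (binom j i * (J - I)) ≡⟨ cong (- sign i * fact i *_) (binom-absorb j i) ⟩
  - sign i * fact i * (binom j (suc i) * ℕ→ℚ (suc i))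
    ≡⟨ push (sign i) (fact i) (binom j (suc i)) (ℕ→ℚ (suc i)) ⟩
  - sign i * binom j (suc i) * (fact i * ℕ→ℚ (suc i)) ∎
  where
  J = ℕ→ℚ j
  I = ℕ→ℚ i
  pull : ∀ s b f x y → s * b * f * (- x + y) ≡ - s * f * (b * (x - y))
  pull = solve-∀ ℚ-ring
  push : ∀ s f b x → - s * f * (b * x) ≡ - s * b * (f * x)
  push = solve-∀ ℚ-ring

poch-threeHalves : ∀ i → poch threeHalves i ≡ poch half i * ℕ→ℚ (2 ℕ.* i ℕ.+ 1)
poch-threeHalves zero    = refl
poch-threeHalves (suc i) = begin
  poch threeHalves i * (threeHalves + I)
    ≡⟨ cong (_* (threeHalves + I)) (trans (poch-threeHalves i) (cong (poch half i *_) (ℕ→ℚ-odd i))) ⟩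
  poch half i * (I + I + 1ℚ) * (threeHalves + I)
    ≡⟨ regroup (poch half i) I ⟩
  poch half i * (half + I) * ((1ℚ + I) + (1ℚ + I) + 1ℚ)
    ≡⟨ cong (λ x → poch half i * (half + I) * (x + x + 1ℚ)) (sym (ℕ→ℚ-suc i)) ⟩
  poch half i * (half + I) * (ℕ→ℚ (suc i) + ℕ→ℚ (suc i) + 1ℚ)
    ≡⟨ cong (poch half i * (half + I) *_) (sym (ℕ→ℚ-odd (suc i))) ⟩
  poch half i * (half + I) * ℕ→ℚ (2 ℕ.* suc i ℕ.+ 1)
    ∎
  where
  I = ℕ→ℚ i
  regroup : ∀ p x → p * (x + x + 1ℚ) * (threeHalves + x) ≡ p * (half + x) * ((1ℚ + x) + (1ℚ + x) + 1ℚ)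
  regroup = solve-∀ ℚ-ring

reciprocalOddPower : ℕ → ℕ → ℚ
reciprocalOddPower s k = 1ℚ ÷ᵗ (ℕ→ℚ (2 ℕ.* k ℕ.+ 1) ^ℚ s)

hgNumerator-halves : ∀ s j i →
  prodℚ (map (λ b → poch b i) (replicate s half ++ (1ℚ - ℕ→ℚ (suc j) ∷ []))) * (1ℚ ^ℚ i)
    ≡ poch half i ^ℚ s * (sign i * binom j i * fact i)
hgNumerator-halves s j i = begin
  prodℚ (pochs (replicate s half ++ (1ℚ - ℕ→ℚ (suc j) ∷ []))) * (1ℚ ^ℚ i)
    ≡⟨ cong₂ _*_ (trans (cong prodℚ (map-++ _ (replicate s half) _)) (prodℚ-++ (pochs (replicate s half)) _)) (1^ℚ i) ⟩
  prodℚ (pochs (replicate s half)) * (poch (1ℚ - ℕ→ℚ (suc j)) i * 1ℚ) * 1ℚ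
    ≡⟨ *-identityʳ _ ⟩
  prodℚ (pochs (replicate s half)) * (poch (1ℚ - ℕ→ℚ (suc j)) i * 1ℚ)
    ≡⟨ cong₂ _*_ (prodℚ-map-replicate _ half s) (*-identityʳ _) ⟩
  poch half i ^ℚ s * poch (1ℚ - ℕ→ℚ (suc j)) i
    ≡⟨ cong (λ c → poch half i ^ℚ s * poch c i) 1-[1+j]≡-j ⟩
  poch half i ^ℚ s * poch (- ℕ→ℚ j) i
    ≡⟨ cong (poch half i ^ℚ s *_) (poch-neg j i) ⟩
  poch half i ^ℚ s * (sign i * binom j i * fact i)
    ∎
  where
  pochs : List ℚ → List ℚ
  pochs = map (λ b → poch b i)
  cancel : ∀ x → 1ℚ - (1ℚ + x) ≡ - x
  cancel = solve-∀ ℚ-ring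
  1-[1+j]≡-j : 1ℚ - ℕ→ℚ (suc j) ≡ - ℕ→ℚ j
  1-[1+j]≡-j = trans (cong (λ x → 1ℚ - x) (ℕ→ℚ-suc j)) (cancel (ℕ→ℚ j))

hgDenominator-threeHalves : ∀ s i →
  prodℚ (map (λ b → poch b i) (replicate s threeHalves)) * fact i
    ≡ poch half i ^ℚ s * ℕ→ℚ (2 ℕ.* i ℕ.+ 1) ^ℚ s * fact i
hgDenominator-threeHalves s i = cong (_* fact i) (begin
  prodℚ (map (λ b → poch b i) (replicate s threeHalves)) ≡⟨ prodℚ-map-replicate _ threeHalves s ⟩
  poch threeHalves i ^ℚ s                                ≡⟨ cong (_^ℚ s) (poch-threeHalves i) ⟩
  (poch half i * D) ^ℚ s                                 ≡⟨ ^ℚ-*-distrib (poch half i) D s ⟩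
  poch half i ^ℚ s * D ^ℚ s                              ∎)
  where
  D = ℕ→ℚ (2 ℕ.* i ℕ.+ 1)

hgTerm-halves : ∀ s j i →
  hgTerm (replicate s half ++ (1ℚ - ℕ→ℚ (suc j) ∷ [])) (replicate s threeHalves) 1ℚ i
    ≡ binom j i * (sign i * reciprocalOddPower s i)
hgTerm-halves s j i = begin
  hgTerm (replicate s half ++ (1ℚ - ℕ→ℚ (suc j) ∷ [])) (replicate s threeHalves) 1ℚ i
    ≡⟨ cong₂ _÷ᵗ_ (hgNumerator-halves s j i) (hgDenominator-threeHalves s i) ⟩
  (Pˢ * (S * B * F)) ÷ᵗ (Pˢ * Dˢ * F)
    ≡⟨ ÷ᵗ-unique (pos⇒≢0 (pos*pos⇒pos (Pˢ * Dˢ) {{pos*pos⇒pos Pˢ Dˢ}} F {{fact-pos i}})) multiply ⟩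
  B * (S * A)
    ∎
  where
  D = ℕ→ℚ (2 ℕ.* i ℕ.+ 1)
  Pˢ = poch half i ^ℚ s
  Dˢ = D ^ℚ s
  S = sign i
  B = binom j i
  F = fact i
  A = reciprocalOddPower s i
  instance
    Pˢ>0 : Positive Pˢ
    Pˢ>0 = ^ℚ-pos (poch half i) {{poch-pos half i}} s
    Dˢ>0 : Positive Dˢ
    Dˢ>0 = ^ℚ-pos D {{ℕ→ℚ-odd-pos i}} s
  regroup : ∀ b t a p d f → b * (t * a) * (p * d * f) ≡ p * (t * b * f) * (a * d)
  regroup = solve-∀ ℚ-ring
  multiply : B * (S * A) * (Pˢ * Dˢ * F) ≡ Pˢ * (S * B * F)
  multiply = begin
    B * (S * A) * (Pˢ * Dˢ * F)    ≡⟨ regroup B S A Pˢ Dˢ F ⟩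
    Pˢ * (S * B * F) * (A * Dˢ)    ≡⟨ cong (Pˢ * (S * B * F) *_) (÷ᵗ-*-cancel 1ℚ Dˢ (pos⇒≢0 Dˢ>0)) ⟩
    Pˢ * (S * B * F) * 1ℚ          ≡⟨ *-identityʳ _ ⟩
    Pˢ * (S * B * F)               ∎

hypergeomTerm≡binomialTransform : ∀ s j →
  hypergeomTerm (suc j) (replicate s half) (replicate s threeHalves) 1ℚ
    ≡ binomialTransform (reciprocalOddPower s) j
hypergeomTerm≡binomialTransform s j = begin
  Σ< (suc (suc j)) T
    ≡⟨ Σ<-cong (suc (suc j)) (hgTerm-halves s j) ⟩
  Σ< (suc (suc j)) (λ i → binom j i * (sign i * reciprocalOddPower s i))
    ≡⟨ Σ<-extend (suc j) (binom[n,1+n]*x≡0 j _) ⟩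
  binomialTransform (reciprocalOddPower s) j
    ∎
  where
  T = hgTerm (replicate s half ++ (1ℚ - ℕ→ℚ (suc j) ∷ [])) (replicate s threeHalves) 1ℚ

corollary3p2 : (n s : ℕ) → 1 ≤ n → 1 ≤ s → lhs n s ≡ rhs n s
-- The identity holds for all n and s.
corollary3p2 n s _ _ = sym (begin
  rhs n s
    ≡⟨ Σ<-cong n (λ j → trans (cong (sign j * binom n (suc j) *_) (hypergeomTerm≡binomialTransform s j))
                              (swap (sign j) (binom n (suc j)) _)) ⟩
  Σ< n (λ j → binom n (suc j) * (sign j * binomialTransform (reciprocalOddPower s) j))
    ≡⟨ Σ<-binomialTransform n (reciprocalOddPower s) ⟩
  lhs n s
    ∎)
  where
  swap : ∀ x y z → x * y * z ≡ y * (x * z)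
  swap = solve-∀ ℚ-ring
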